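{- Let $k\ge1$, let $t_1,\dots,t_k$ be variables and $\omega=(\omega_1,\omega_2,\dots)$ a sequence of integers. Then for every $n\ge k+1$, $$P_{\omega,k,n}(t_1,\dots,t_k)=\sum_{j=1}^k t_j\,P_{\omega,k,n-j}(t_1,\dots,t_k).$$
   Context: For $n\ge1$, the weighted isobaric polynomial is $$P_{\omega,k,n}(t_1,\dots,t_k)=\sum_{\alpha}\binom{|\alpha|}{\alpha_1,\dots,\alpha_k}\frac{\sum_{j=1}^k\omega_j\alpha_j}{|\alpha|}\,t_1^{\alpha_1}\cdots t_k^{\alpha_k},$$ summing over all $\alpha=(\alpha_1,\dots,\alpha_k)\in\mathbb{Z}_{\ge0}^k$ with $\sum_j j\alpha_j=n$, where $|\alpha|=\sum_j\alpha_j$ and the first factor is a multinomial coefficient. -}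

module Defs where

open import Data.Nat as ℕ using (ℕ; zero; suc; _!; _≟_)
open import Data.Integer as ℤ using (ℤ; +_)
open import Data.Rational as ℚ using (ℚ; 0ℚ; _/_)
open import Data.Fin using (Fin; toℕ)
import Data.Fin as Fin
open import Relation.Nullary using (yes; no)

-- Exponent vectors α = (α₁,…,αₖ); index i : Fin k stands for j = toℕ i + 1.
Exp : ℕ → Set
Exp k = Fin k → ℕ

-- A polynomial in t₁,…,tₖ with rational coefficients, given by its
-- coefficient function  α ↦ [t^α] P.
Poly : ℕ → Set
Poly k = Exp k → ℚ

sumℕ : ∀ {k} → (Fin k → ℕ) → ℕ
sumℕ {zero}  f = 0
sumℕ {suc k} f = f Fin.zero ℕ.+ sumℕ (λ i → f (Fin.suc i))

sumℤ : ∀ {k} → (Fin k → ℤ) → ℤ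
sumℤ {zero}  f = + 0
sumℤ {suc k} f = f Fin.zero ℤ.+ sumℤ (λ i → f (Fin.suc i))

prodℕ : ∀ {k} → (Fin k → ℕ) → ℕ
prodℕ {zero}  f = 1
prodℕ {suc k} f = f Fin.zero ℕ.* prodℕ (λ i → f (Fin.suc i))

sumPoly : ∀ {k} {m} → (Fin m → Poly k) → Poly k
sumPoly {m = zero}  F α = 0ℚ
sumPoly {m = suc m} F α = F Fin.zero α ℚ.+ sumPoly (λ i → F (Fin.suc i)) α

-- a / b as a rational number (b is never 0 where it is used; 0 by convention)
divℤ : ℤ → ℕ → ℚ
divℤ a zero    = 0ℚ
divℤ a (suc b) = a / suc b

size : ∀ {k} → Exp k → ℕ
size α = sumℕ α

wdeg : ∀ {k} → Exp k → ℕ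
wdeg α = sumℕ (λ i → suc (toℕ i) ℕ.* α i)

multinomial : ∀ {k} → Exp k → ℚ
multinomial α = divℤ (+ (size α !)) (prodℕ (λ i → α i !))

-- coefficient of t^α in P_{ω,k,n}; ω = (ω₁,ω₂,…) is given as ω : ℕ → ℤ
-- with ω j = ω_j (ω 0 is unused).
P : (ω : ℕ → ℤ) (k n : ℕ) → Poly k
P ω k n α with wdeg α ≟ n
... | yes _ = multinomial α ℚ.* divℤ (sumℤ (λ i → ω (suc (toℕ i)) ℤ.* + α i)) (size α)
... | no  _ = 0ℚ

update : ∀ {k} → Exp k → Fin k → ℕ → Exp k
update α i m l with l Fin.≟ i
... | yes _ = m
... | no  _ = α l

-- multiplication of a polynomial by the variable t_j (j = toℕ i + 1):
-- [t^α](t_j Q) = [t^(α - e_j)] Q if α_j ≥ 1, else 0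
mulVar : ∀ {k} → Fin k → Poly k → Poly k
mulVar i Q α with α i
... | zero  = 0ℚ
... | suc m = Q (update α i m)

{-# OPTIONS --safe #-}
-- Compare coefficients of t^α.  Off the weighted degree n both sides vanish.  On it,
-- s = |α| ≥ 2 because n > k, and every coefficient involved is a fraction over
-- Π αᵢ!: the left side is (s-1)! W / Π αᵢ! with W = Σ ωⱼ αⱼ, and the tⱼ-term is
-- (s-2)! αⱼ (W - ωⱼ) / Π αᵢ!, since lowering αⱼ by one divides Π αᵢ! by αⱼ and
-- lowers W by ωⱼ.  The recurrence thus reduces to Σⱼ αⱼ (W - ωⱼ) = (s-1) W.
module Submission where

open import Defs
open import Algebra.Bundles using (CommutativeMonoid)
import Algebra.Properties.CommutativeMonoid.Sum
open import Data.Nat as ℕ using (ℕ; zero; suc; _!; _≤_; _<_; _∸_; NonZero)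
import Data.Nat.Properties as ℕ
open import Data.Integer as ℤ using (ℤ; +_)
import Data.Integer.Properties as ℤ
open import Data.Integer.Tactic.RingSolver using (solve-∀)
open import Data.Rational as ℚ using (ℚ; 0ℚ; fromℚᵘ)
import Data.Rational.Properties as ℚ
open import Data.Rational.Properties
  using (toℚᵘ-injective; toℚᵘ-fromℚᵘ; toℚᵘ-homo-+; toℚᵘ-homo-*; fromℚᵘ-cong; 0/n≡0)
import Data.Rational.Unnormalised as ℚᵘ
open import Data.Rational.Unnormalised using (mkℚᵘ; *≡*)
import Data.Rational.Unnormalised.Properties as ℚᵘ
open import Data.Fin as Fin using (Fin; zero; suc; toℕ; punchIn)
open import Data.Fin.Properties using (punchInᵢ≢i; toℕ<n)
open import Function using (_∘_; case_of_)
open import Relation.Nullary using (yes; no; contradiction)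
open import Relation.Binary.PropositionalEquality
  using (_≡_; _≢_; refl; sym; trans; cong; cong₂; module ≡-Reasoning)

fromℚᵘ-homo-+ : ∀ p q → fromℚᵘ (p ℚᵘ.+ q) ≡ fromℚᵘ p ℚ.+ fromℚᵘ q
fromℚᵘ-homo-+ p q = toℚᵘ-injective (ℚᵘ.≃-trans (toℚᵘ-fromℚᵘ _) (ℚᵘ.≃-sym
  (ℚᵘ.≃-trans (toℚᵘ-homo-+ (fromℚᵘ p) (fromℚᵘ q))
              (ℚᵘ.+-cong (toℚᵘ-fromℚᵘ p) (toℚᵘ-fromℚᵘ q)))))

fromℚᵘ-homo-* : ∀ p q → fromℚᵘ (p ℚᵘ.* q) ≡ fromℚᵘ p ℚ.* fromℚᵘ q
fromℚᵘ-homo-* p q = toℚᵘ-injective (ℚᵘ.≃-trans (toℚᵘ-fromℚᵘ _) (ℚᵘ.≃-sym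
  (ℚᵘ.≃-trans (toℚᵘ-homo-* (fromℚᵘ p) (fromℚᵘ q))
              (ℚᵘ.*-cong (toℚᵘ-fromℚᵘ p) (toℚᵘ-fromℚᵘ q)))))

divℤ-cross : ∀ a b {d e} .{{_ : NonZero d}} .{{_ : NonZero e}} →
             a ℤ.* + e ≡ b ℤ.* + d → divℤ a d ≡ divℤ b e
divℤ-cross a b {suc d} {suc e} eq = fromℚᵘ-cong {mkℚᵘ a d} {mkℚᵘ b e} (*≡* eq)

divℤ-* : ∀ a b {d e} .{{_ : NonZero d}} .{{_ : NonZero e}} →
         divℤ a d ℚ.* divℤ b e ≡ divℤ (a ℤ.* b) (d ℕ.* e)
divℤ-* a b {suc d} {suc e} = sym (fromℚᵘ-homo-* (mkℚᵘ a d) (mkℚᵘ b e))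

divℤ-+ : ∀ a b {d} .{{_ : NonZero d}} → divℤ a d ℚ.+ divℤ b d ≡ divℤ (a ℤ.+ b) d
divℤ-+ a b {suc d} = trans (sym (fromℚᵘ-homo-+ (mkℚᵘ a d) (mkℚᵘ b d)))
  (divℤ-cross (a ℤ.* D ℤ.+ b ℤ.* D) (a ℤ.+ b) {suc d ℕ.* suc d} {suc d}
    (trans (factor a b D) (cong ((a ℤ.+ b) ℤ.*_) (sym (ℤ.pos-* (suc d) (suc d))))))
  where
  D = + suc d
  factor : ∀ a b d → (a ℤ.* d ℤ.+ b ℤ.* d) ℤ.* d ≡ (a ℤ.+ b) ℤ.* (d ℤ.* d)
  factor = solve-∀

divℤ-0 : ∀ d .{{_ : NonZero d}} → divℤ (+ 0) d ≡ 0ℚ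
divℤ-0 (suc d) = 0/n≡0 (suc d)

update-≡ : ∀ {k} (α : Exp k) i m → update α i m i ≡ m
update-≡ α i m with i Fin.≟ i
... | yes _   = refl
... | no  i≢i = contradiction refl i≢i

update-≢ : ∀ {k} (α : Exp k) {i l} m → l ≢ i → update α i m l ≡ α l
update-≢ α {i} {l} m l≢i with l Fin.≟ i
... | yes l≡i = contradiction l≡i l≢i
... | no  _   = refl

module _ {c ℓ} (M : CommutativeMonoid c ℓ) where
  open CommutativeMonoid M
    using (Carrier; _≈_; _∙_; ∙-cong; ∙-congˡ; assoc; setoid; reflexive)
    renaming (sym to ≈-sym; trans to ≈-trans)
  open import Algebra.Properties.CommutativeMonoid.Sum M using (sum; sum-remove; sum-cong-≗)
  open import Relation.Binary.Reasoning.Setoid setoid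

  sum-update : ∀ {k} (h : Fin k → ℕ → Carrier) (α : Exp k) i m {x} →
               h i (α i) ≈ x ∙ h i m →
               sum (λ l → h l (α l)) ≈ x ∙ sum (λ l → h l (update α i m l))
  sum-update {suc k} h α i m {x} hᵢ = begin
    sum f                              ≈⟨ sum-remove f ⟩
    f i ∙ sum (f ∘ punchIn i)          ≈⟨ ∙-cong hᵢ (reflexive (sum-cong-≗ rest)) ⟩
    (x ∙ h i m) ∙ sum (g ∘ punchIn i)  ≈⟨ assoc x (h i m) _ ⟩
    x ∙ (h i m ∙ sum (g ∘ punchIn i))  ≡⟨ cong (λ y → x ∙ (h i y ∙ sum (g ∘ punchIn i))) (update-≡ α i m) ⟨
    x ∙ (g i ∙ sum (g ∘ punchIn i))    ≈⟨ ∙-congˡ (≈-sym (sum-remove g)) ⟩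
    x ∙ sum g                          ∎
    where
    f g : Fin (suc k) → Carrier
    f l = h l (α l)
    g l = h l (update α i m l)
    rest : ∀ j → f (punchIn i j) ≡ g (punchIn i j)
    rest j = cong (h (punchIn i j)) (sym (update-≢ α m (punchInᵢ≢i i j)))

  module _ (fold : ∀ {k} → (Fin k → Carrier) → Carrier)
           (fold≈sum : ∀ {k} (f : Fin k → Carrier) → fold f ≈ sum f) where

    fold-update : ∀ {k} (h : Fin k → ℕ → Carrier) (α : Exp k) i m {x} →
                  h i (α i) ≈ x ∙ h i m →
                  fold (λ l → h l (α l)) ≈ x ∙ fold (λ l → h l (update α i m l))
    fold-update h α i m hᵢ =
      ≈-trans (fold≈sum _) (≈-trans (sum-update h α i m hᵢ) (∙-congˡ (≈-sym (fold≈sum _))))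

module ℕ+ = Algebra.Properties.CommutativeMonoid.Sum ℕ.+-0-commutativeMonoid
module ℕ* = Algebra.Properties.CommutativeMonoid.Sum ℕ.*-1-commutativeMonoid
module ℤ+ = Algebra.Properties.CommutativeMonoid.Sum ℤ.+-0-commutativeMonoid

sumℕ≡sum : ∀ {k} (f : Fin k → ℕ) → sumℕ f ≡ ℕ+.sum f
sumℕ≡sum {zero}  f = refl
sumℕ≡sum {suc k} f = cong (f zero ℕ.+_) (sumℕ≡sum (f ∘ suc))

sumℤ≡sum : ∀ {k} (f : Fin k → ℤ) → sumℤ f ≡ ℤ+.sum f
sumℤ≡sum {zero}  f = refl
sumℤ≡sum {suc k} f = cong (λ s → f zero ℤ.+ s) (sumℤ≡sum (f ∘ suc))

prodℕ≡product : ∀ {k} (f : Fin k → ℕ) → prodℕ f ≡ ℕ*.sum f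
prodℕ≡product {zero}  f = refl
prodℕ≡product {suc k} f = cong (f zero ℕ.*_) (prodℕ≡product (f ∘ suc))

weight : ∀ {k} → (ℕ → ℤ) → Exp k → ℤ
weight ω α = sumℤ (λ l → ω (suc (toℕ l)) ℤ.* + α l)

factorials : ∀ {k} → Exp k → ℕ
factorials α = prodℕ (λ l → α l !)

module _ {k} (α : Exp k) (i : Fin k) {m} (αᵢ≡1+m : α i ≡ suc m) where

  wdeg-update : wdeg α ≡ suc (toℕ i) ℕ.+ wdeg (update α i m)
  wdeg-update = fold-update ℕ.+-0-commutativeMonoid sumℕ sumℕ≡sum
    (λ l a → suc (toℕ l) ℕ.* a) α i m
    (trans (cong (suc (toℕ i) ℕ.*_) αᵢ≡1+m) (ℕ.*-suc (suc (toℕ i)) m))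

  size-update : size α ≡ suc (size (update α i m))
  size-update = fold-update ℕ.+-0-commutativeMonoid sumℕ sumℕ≡sum (λ _ a → a) α i m αᵢ≡1+m

  weight-update : ∀ ω → weight ω α ≡ ω (suc (toℕ i)) ℤ.+ weight ω (update α i m)
  weight-update ω = fold-update ℤ.+-0-commutativeMonoid sumℤ sumℤ≡sum
    (λ l a → ω (suc (toℕ l)) ℤ.* + a) α i m {ω (suc (toℕ i))}
    (trans (cong (λ a → ω (suc (toℕ i)) ℤ.* + a) αᵢ≡1+m) (ℤ.*-suc (ω (suc (toℕ i))) (+ m)))

  factorials-update : factorials α ≡ suc m ℕ.* factorials (update α i m)
  factorials-update = fold-update ℕ.*-1-commutativeMonoid prodℕ prodℕ≡product
    (λ _ a → a !) α i m {suc m}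
    (cong _! αᵢ≡1+m)

factorials-nonZero : ∀ {k} (α : Exp k) → NonZero (factorials α)
factorials-nonZero {zero}  α = _
factorials-nonZero {suc k} α =
  ℕ.m*n≢0 (α zero !) _ {{α zero ℕ.!≢0}} {{factorials-nonZero (α ∘ suc)}}

factorial-cancel : ∀ s w d .{{_ : NonZero d}} →
                   divℤ (+ (suc s !)) d ℚ.* divℤ w (suc s) ≡ divℤ (+ (s !) ℤ.* w) d
factorial-cancel s w d =
  trans (divℤ-* (+ (suc s !)) w) (divℤ-cross _ _ {{ℕ.m*n≢0 d (suc s)}} cross)
  where
  open ≡-Reasoning
  reorder : ∀ x f w d → x ℤ.* f ℤ.* w ℤ.* d ≡ f ℤ.* w ℤ.* (d ℤ.* x)
  reorder = solve-∀
  cross : + (suc s !) ℤ.* w ℤ.* + d ≡ + (s !) ℤ.* w ℤ.* + (d ℕ.* suc s)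
  cross = begin
    + (suc s ℕ.* s !) ℤ.* w ℤ.* + d      ≡⟨ cong (λ a → a ℤ.* w ℤ.* + d) (ℤ.pos-* (suc s) (s !)) ⟩
    + suc s ℤ.* + (s !) ℤ.* w ℤ.* + d    ≡⟨ reorder (+ suc s) (+ (s !)) w (+ d) ⟩
    + (s !) ℤ.* w ℤ.* (+ d ℤ.* + suc s)  ≡⟨ cong (λ a → + (s !) ℤ.* w ℤ.* a) (ℤ.pos-* d (suc s)) ⟨
    + (s !) ℤ.* w ℤ.* + (d ℕ.* suc s)    ∎

module _ (ω : ℕ → ℤ) {k n : ℕ} where

  P-on-degree : ∀ (α : Exp k) → wdeg α ≡ n →
                P ω k n α ≡ multinomial α ℚ.* divℤ (weight ω α) (size α)
  P-on-degree α deg≡n with wdeg α ℕ.≟ n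
  ... | yes _     = refl
  ... | no deg≢n = contradiction deg≡n deg≢n

  P-off-degree : ∀ (α : Exp k) → wdeg α ≢ n → P ω k n α ≡ 0ℚ
  P-off-degree α deg≢n with wdeg α ℕ.≟ n
  ... | yes deg≡n = contradiction deg≡n deg≢n
  ... | no _      = refl

  P-on-degree-over-factorials : ∀ (α : Exp k) {s} → wdeg α ≡ n → size α ≡ suc s →
                        P ω k n α ≡ divℤ (+ (s !) ℤ.* weight ω α) (factorials α)
  P-on-degree-over-factorials α {s} deg≡n size≡1+s = begin
    P ω k n α
      ≡⟨ P-on-degree α deg≡n ⟩
    divℤ (+ (size α !)) (factorials α) ℚ.* divℤ (weight ω α) (size α)
      ≡⟨ cong (λ t → divℤ (+ (t !)) (factorials α) ℚ.* divℤ (weight ω α) t) size≡1+s ⟩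
    divℤ (+ (suc s !)) (factorials α) ℚ.* divℤ (weight ω α) (suc s)
      ≡⟨ factorial-cancel s (weight ω α) (factorials α) {{factorials-nonZero α}} ⟩
    divℤ (+ (s !) ℤ.* weight ω α) (factorials α) ∎
    where open ≡-Reasoning

module _ (ω : ℕ → ℤ) {k n : ℕ} (α : Exp k) (i : Fin k) where
  private
    j : ℕ
    j = suc (toℕ i)

  mulVar-P-off-degree : wdeg α ≢ n → j ≤ n → mulVar i (P ω k (n ∸ j)) α ≡ 0ℚ
  mulVar-P-off-degree deg≢n j≤n with α i in αᵢ≡1+m
  ... | zero  = refl
  ... | suc m = P-off-degree ω (update α i m) λ deg-β≡n-j →
    deg≢n (trans (wdeg-update α i αᵢ≡1+m) (trans (cong (j ℕ.+_) deg-β≡n-j) (ℕ.m+[n∸m]≡n j≤n)))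

  mulVar-P-on-degree : ∀ {s} → wdeg α ≡ n → size α ≡ suc (suc s) →
    mulVar i (P ω k (n ∸ j)) α ≡
    divℤ (+ (s !) ℤ.* (+ α i ℤ.* (weight ω α ℤ.- ω j))) (factorials α)
  mulVar-P-on-degree {s} deg≡n size≡2+s with α i in αᵢ≡1+m
  ... | zero  = sym (trans (cong (λ a → divℤ a (factorials α)) (ℤ.*-zeroʳ (+ (s !))))
                           (divℤ-0 (factorials α) {{factorials-nonZero α}}))
  ... | suc m = begin
    P ω k (n ∸ j) β
      ≡⟨ P-on-degree-over-factorials ω β deg-β size-β ⟩
    divℤ (+ (s !) ℤ.* weight ω β) (factorials β)
      ≡⟨ divℤ-cross _ _ {{factorials-nonZero β}} {{factorials-nonZero α}} cross ⟩
    divℤ (+ (s !) ℤ.* (+ suc m ℤ.* (weight ω α ℤ.- ω j))) (factorials α) ∎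
    where
    open ≡-Reasoning
    β = update α i m
    deg-β : wdeg β ≡ n ∸ j
    deg-β = trans (sym (ℕ.m+n∸m≡n j (wdeg β)))
                  (cong (_∸ j) (trans (sym (wdeg-update α i αᵢ≡1+m)) deg≡n))
    size-β : size β ≡ suc s
    size-β = ℕ.suc-injective (trans (sym (size-update α i αᵢ≡1+m)) size≡2+s)
    reorder : ∀ f w x p o → f ℤ.* w ℤ.* (x ℤ.* p) ≡ f ℤ.* (x ℤ.* ((o ℤ.+ w) ℤ.- o)) ℤ.* p
    reorder = solve-∀
    cross : + (s !) ℤ.* weight ω β ℤ.* + factorials α ≡
            + (s !) ℤ.* (+ suc m ℤ.* (weight ω α ℤ.- ω j)) ℤ.* + factorials β
    cross = begin
      + (s !) ℤ.* weight ω β ℤ.* + factorials α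
        ≡⟨ cong (λ p → + (s !) ℤ.* weight ω β ℤ.* + p) (factorials-update α i αᵢ≡1+m) ⟩
      + (s !) ℤ.* weight ω β ℤ.* + (suc m ℕ.* factorials β)
        ≡⟨ cong (λ p → + (s !) ℤ.* weight ω β ℤ.* p) (ℤ.pos-* (suc m) (factorials β)) ⟩
      + (s !) ℤ.* weight ω β ℤ.* (+ suc m ℤ.* + factorials β)
        ≡⟨ reorder (+ (s !)) (weight ω β) (+ suc m) (+ factorials β) (ω j) ⟩
      + (s !) ℤ.* (+ suc m ℤ.* ((ω j ℤ.+ weight ω β) ℤ.- ω j)) ℤ.* + factorials β
        ≡⟨ cong (λ w → + (s !) ℤ.* (+ suc m ℤ.* (w ℤ.- ω j)) ℤ.* + factorials β)
                (weight-update α i αᵢ≡1+m ω) ⟨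
      + (s !) ℤ.* (+ suc m ℤ.* (weight ω α ℤ.- ω j)) ℤ.* + factorials β ∎

sumPoly-0 : ∀ {k m} (F : Fin m → Poly k) α → (∀ i → F i α ≡ 0ℚ) → sumPoly F α ≡ 0ℚ
sumPoly-0 {m = zero}  F α F≡0 = refl
sumPoly-0 {m = suc m} F α F≡0 =
  trans (cong₂ ℚ._+_ (F≡0 zero) (sumPoly-0 (F ∘ suc) α (F≡0 ∘ suc))) (ℚ.+-identityʳ 0ℚ)

sumPoly-divℤ : ∀ {k m} (F : Fin m → Poly k) α (N : Fin m → ℤ) d .{{_ : NonZero d}} →
               (∀ i → F i α ≡ divℤ (N i) d) → sumPoly F α ≡ divℤ (sumℤ N) d
sumPoly-divℤ {m = zero}  F α N d F≡N/d = sym (divℤ-0 d)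
sumPoly-divℤ {m = suc m} F α N d F≡N/d =
  trans (cong₂ ℚ._+_ (F≡N/d zero) (sumPoly-divℤ (F ∘ suc) α (N ∘ suc) d (F≡N/d ∘ suc)))
        (divℤ-+ (N zero) (sumℤ (N ∘ suc)))

sumℤ-*ˡ : ∀ {k} c (f : Fin k → ℤ) → sumℤ (λ i → c ℤ.* f i) ≡ c ℤ.* sumℤ f
sumℤ-*ˡ {zero}  c f = sym (ℤ.*-zeroʳ c)
sumℤ-*ˡ {suc k} c f = trans (cong (λ s → c ℤ.* f zero ℤ.+ s) (sumℤ-*ˡ c (f ∘ suc)))
                            (sym (ℤ.*-distribˡ-+ c (f zero) (sumℤ (f ∘ suc))))

sumℤ-deviations : ∀ {k} (a : Fin k → ℕ) (w : Fin k → ℤ) x →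
  sumℤ (λ i → + a i ℤ.* (x ℤ.- w i)) ≡ + sumℕ a ℤ.* x ℤ.- sumℤ (λ i → w i ℤ.* + a i)
sumℤ-deviations {zero}  a w x = sym (ℤ.+-identityʳ (+ 0 ℤ.* x))
sumℤ-deviations {suc k} a w x = begin
  + a zero ℤ.* (x ℤ.- w zero) ℤ.+ sumℤ (λ i → + a (suc i) ℤ.* (x ℤ.- w (suc i)))
    ≡⟨ cong (λ t → + a zero ℤ.* (x ℤ.- w zero) ℤ.+ t) (sumℤ-deviations (a ∘ suc) (w ∘ suc) x) ⟩
  + a zero ℤ.* (x ℤ.- w zero) ℤ.+ (+ A ℤ.* x ℤ.- T)
    ≡⟨ regroup (+ a zero) (+ A) x (w zero) T ⟩
  (+ a zero ℤ.+ + A) ℤ.* x ℤ.- (w zero ℤ.* + a zero ℤ.+ T)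
    ≡⟨ cong (λ t → t ℤ.* x ℤ.- (w zero ℤ.* + a zero ℤ.+ T)) (ℤ.pos-+ (a zero) A) ⟨
  + sumℕ a ℤ.* x ℤ.- sumℤ (λ i → w i ℤ.* + a i) ∎
  where
  open ≡-Reasoning
  A = sumℕ (a ∘ suc)
  T = sumℤ (λ i → w (suc i) ℤ.* + a (suc i))
  regroup : ∀ a₀ A x w₀ T →
            a₀ ℤ.* (x ℤ.- w₀) ℤ.+ (A ℤ.* x ℤ.- T) ≡ (a₀ ℤ.+ A) ℤ.* x ℤ.- (w₀ ℤ.* a₀ ℤ.+ T)
  regroup = solve-∀

sumℕ-*-≤ : ∀ {k} (c : Fin k → ℕ) K (a : Fin k → ℕ) → (∀ i → c i ≤ K) →
           sumℕ (λ i → c i ℕ.* a i) ≤ K ℕ.* sumℕ a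
sumℕ-*-≤ {zero}  c K a c≤K = ℕ.z≤n
sumℕ-*-≤ {suc k} c K a c≤K = ℕ.≤-trans
  (ℕ.+-mono-≤ (ℕ.*-monoˡ-≤ (a zero) (c≤K zero)) (sumℕ-*-≤ (c ∘ suc) K (a ∘ suc) (c≤K ∘ suc)))
  (ℕ.≤-reflexive (sym (ℕ.*-distribˡ-+ K (a zero) (sumℕ (a ∘ suc)))))

wdeg≤k*size : ∀ {k} (α : Exp k) → wdeg α ≤ k ℕ.* size α
wdeg≤k*size {k} α = sumℕ-*-≤ (λ i → suc (toℕ i)) k α toℕ<n

size≥2 : ∀ {k} (α : Exp k) → k < wdeg α → 2 ≤ size α
size≥2 {k} α k<deg = ℕ.≮⇒≥ λ size<2 → ℕ.1+n≰n (begin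
  suc k            ≤⟨ k<deg ⟩
  wdeg α           ≤⟨ wdeg≤k*size α ⟩
  k ℕ.* size α     ≤⟨ ℕ.*-monoʳ-≤ k (ℕ.≤-pred size<2) ⟩
  k ℕ.* 1          ≡⟨ ℕ.*-identityʳ k ⟩
  k                ∎)
  where open ℕ.≤-Reasoning

module _ (ω : ℕ → ℤ) {k} (α : Exp k) {s} (size≡2+s : size α ≡ suc (suc s)) where

  factorial*weight≡sum-deviations : + (suc s !) ℤ.* weight ω α ≡
    + (s !) ℤ.* sumℤ (λ i → + α i ℤ.* (weight ω α ℤ.- ω (suc (toℕ i))))
  factorial*weight≡sum-deviations = begin
    + (suc s !) ℤ.* W
      ≡⟨ cong (ℤ._* W) (ℤ.pos-* (suc s) (s !)) ⟩
    + suc s ℤ.* + (s !) ℤ.* W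
      ≡⟨ regroup (+ suc s) (+ (s !)) W ⟩
    + (s !) ℤ.* ((ℤ.1ℤ ℤ.+ + suc s) ℤ.* W ℤ.- W)
      ≡⟨ cong (λ x → + (s !) ℤ.* (x ℤ.* W ℤ.- W)) (ℤ.pos-+ 1 (suc s)) ⟨
    + (s !) ℤ.* (+ suc (suc s) ℤ.* W ℤ.- W)
      ≡⟨ cong (λ x → + (s !) ℤ.* (+ x ℤ.* W ℤ.- W)) size≡2+s ⟨
    + (s !) ℤ.* (+ size α ℤ.* W ℤ.- W)
      ≡⟨ cong (+ (s !) ℤ.*_) (sumℤ-deviations α (λ i → ω (suc (toℕ i))) W) ⟨
    + (s !) ℤ.* sumℤ (λ i → + α i ℤ.* (W ℤ.- ω (suc (toℕ i)))) ∎
    where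
    open ≡-Reasoning
    W = weight ω α
    regroup : ∀ x f w → x ℤ.* f ℤ.* w ≡ f ℤ.* ((ℤ.1ℤ ℤ.+ x) ℤ.* w ℤ.- w)
    regroup = solve-∀

module _ (ω : ℕ → ℤ) {k n : ℕ} (α : Exp k) where
  private
    R : Poly k
    R = sumPoly (λ i → mulVar i (P ω k (n ∸ suc (toℕ i))))

  P-recurrence-off-degree : k < n → wdeg α ≢ n → P ω k n α ≡ R α
  P-recurrence-off-degree k<n deg≢n = trans (P-off-degree ω α deg≢n)
    (sym (sumPoly-0 _ α λ i → mulVar-P-off-degree ω α i deg≢n (j≤n i)))
    where
    j≤n : ∀ i → suc (toℕ i) ≤ n
    j≤n i = ℕ.≤-trans (toℕ<n i) (ℕ.<⇒≤ k<n)

  P-recurrence-on-degree : k < n → wdeg α ≡ n → P ω k n α ≡ R α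
  P-recurrence-on-degree k<n deg≡n = begin
    P ω k n α
      ≡⟨ P-on-degree-over-factorials ω α deg≡n size≡2+s ⟩
    divℤ (+ (suc s !) ℤ.* weight ω α) (factorials α)
      ≡⟨ cong (λ a → divℤ a (factorials α)) (factorial*weight≡sum-deviations ω α size≡2+s) ⟩
    divℤ (+ (s !) ℤ.* sumℤ N) (factorials α)
      ≡⟨ cong (λ a → divℤ a (factorials α)) (sumℤ-*ˡ (+ (s !)) N) ⟨
    divℤ (sumℤ (λ i → + (s !) ℤ.* N i)) (factorials α)
      ≡⟨ sumPoly-divℤ _ α _ (factorials α) {{factorials-nonZero α}}
           (λ i → mulVar-P-on-degree ω α i deg≡n size≡2+s) ⟨
    R α ∎
    where
    open ≡-Reasoning
    s = size α ∸ 2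
    size≡2+s : size α ≡ suc (suc s)
    size≡2+s = sym (ℕ.m+[n∸m]≡n (size≥2 α (ℕ.≤-trans k<n (ℕ.≤-reflexive (sym deg≡n)))))
    N : Fin k → ℤ
    N i = + α i ℤ.* (weight ω α ℤ.- ω (suc (toℕ i)))

proposition1 : (k : ℕ) → 1 ≤ k → (ω : ℕ → ℤ) → (n : ℕ) → suc k ≤ n →
    (α : Exp k) →
    P ω k n α ≡ sumPoly (λ i → mulVar i (P ω k (n ∸ suc (toℕ i)))) α
proposition1 k _ ω n k<n α = case wdeg α ℕ.≟ n of λ where
  (yes deg≡n) → P-recurrence-on-degree ω α k<n deg≡n
  (no  deg≢n) → P-recurrence-off-degree ω α k<n deg≢n
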